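{- Let $G$ be a chordal graph of order at least $3$. Then $G$ is strongly $2$-monophonic if and only if $G$ is isomorphic to $K_n-e$ (the complete graph on $n$ vertices with one edge removed) for some $n\ge 3$.
   Context: All graphs are finite and simple. A graph is chordal if it has no induced cycle of length greater than $3$. For a graph $G$ and $u,v\in V(G)$, the monophonic interval $J_G(u,v)$ is the set of all vertices lying on some induced $u,v$-path in $G$, with the convention $u,v\in J_G(u,v)$. A set $S\subseteq V(G)$ is monophonic if for every $w\in V(G)$ there exist $x,y\in S$ with $w\in J_G(x,y)$; $m(G)$ is the minimum size of a monophonic set. $G$ is $2$-monophonic if $m(G)=2$, and strongly $2$-monophonic if it is $2$-monophonic and $\{x,y\}$ is a monophonic set for every pair of non-adjacent vertices $x,y$. -}

module Defs where

open import Data.Nat using (ℕ; zero; suc; _+_; _≤_; _≡ᵇ_; _%_)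
open import Data.Nat.Properties using ()
open import Data.Bool using (Bool; true; false; not; _∧_; _∨_)
open import Data.Fin using (Fin; toℕ) renaming (zero to fzero; suc to fsuc)
open import Data.Fin.Subset using (Subset; _∈_; ∣_∣)
open import Data.Product using (Σ; ∃; _×_; _,_)
open import Data.Sum using (_⊎_)
open import Relation.Binary.PropositionalEquality using (_≡_; _≢_)
open import Relation.Nullary using (¬_)
open import Function.Bundles using (_⇔_; _↔_; Inverse)
open import Function.Definitions using (Injective)

Graph : ℕ → Set
Graph n = Fin n → Fin n → Bool

Adj : ∀ {n} → Graph n → Fin n → Fin n → Set
Adj G u v = G u v ≡ true

IsSimple : ∀ {n} → Graph n → Set
IsSimple G = (∀ u → G u u ≡ false) × (∀ u v → G u v ≡ G v u)

Consecutive : ℕ → ℕ → Set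
Consecutive i j = (suc i ≡ j) ⊎ (suc j ≡ i)

record InducedPath {n} (G : Graph n) (u v : Fin n) : Set where
  field
    k      : ℕ
    vtx    : Fin (suc k) → Fin n
    inj    : Injective _≡_ _≡_ vtx
    start  : vtx fzero ≡ u
    end    : vtx (Data.Fin.fromℕ k) ≡ v
    induced : ∀ i j → (Adj G (vtx i) (vtx j) ⇔ Consecutive (toℕ i) (toℕ j))

CycConsecutive : (m : ℕ) → Fin (suc m) → Fin (suc m) → Set
CycConsecutive m i j =
  ((suc (toℕ i)) % (suc m) ≡ toℕ j) ⊎ ((suc (toℕ j)) % (suc m) ≡ toℕ i)

-- An induced cycle of length m + 4 (i.e. of length greater than 3)
record LongInducedCycle {n} (G : Graph n) : Set where
  field
    m      : ℕ
    vtx    : Fin (suc (suc (suc (suc m)))) → Fin n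
    inj    : Injective _≡_ _≡_ vtx
    induced : ∀ i j → (Adj G (vtx i) (vtx j) ⇔ CycConsecutive (suc (suc (suc m))) i j)

Chordal : ∀ {n} → Graph n → Set
Chordal G = ¬ LongInducedCycle G

InJ : ∀ {n} → Graph n → Fin n → Fin n → Fin n → Set
InJ G u v w = (w ≡ u) ⊎ (w ≡ v) ⊎
  (Σ (InducedPath G u v) λ P → ∃ λ i → InducedPath.vtx P i ≡ w)

Monophonic : ∀ {n} → Graph n → Subset n → Set
Monophonic {n} G S = ∀ (w : Fin n) → ∃ λ x → ∃ λ y → (x ∈ S) × (y ∈ S) × InJ G x y w

TwoMonophonic : ∀ {n} → Graph n → Set
TwoMonophonic {n} G =
  (Σ (Subset n) λ S → Monophonic G S × ∣ S ∣ ≡ 2)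
  × (∀ (S : Subset n) → Monophonic G S → 2 ≤ ∣ S ∣)

pair : ∀ {n} → Fin n → Fin n → Subset n
pair x y = Data.Fin.Subset._∪_ (Data.Fin.Subset.⁅_⁆ x) (Data.Fin.Subset.⁅_⁆ y)

StronglyTwoMonophonic : ∀ {n} → Graph n → Set
StronglyTwoMonophonic {n} G =
  TwoMonophonic G
  × (∀ (x y : Fin n) → x ≢ y → G x y ≡ false → Monophonic G (pair x y))

-- K_m - e : complete graph on Fin m with the edge {0,1} removed
KminusE : (m : ℕ) → Graph m
KminusE m i j =
  not (toℕ i ≡ᵇ toℕ j)
  ∧ not (((toℕ i ≡ᵇ 0) ∧ (toℕ j ≡ᵇ 1)) ∨ ((toℕ i ≡ᵇ 1) ∧ (toℕ j ≡ᵇ 0)))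

Isomorphic : ∀ {n m} → Graph n → Graph m → Set
Isomorphic {n} {m} G H =
  Σ (Fin n ↔ Fin m) λ f → ∀ u v → G u v ≡ H (Inverse.to f u) (Inverse.to f v)

-- Let x, y be non-adjacent vertices of a chordal graph such that every vertex lies on an
-- induced x,y-path.  Then the neighbourhood of x is a clique: two non-adjacent neighbours p, q
-- of x lie on such paths, whose parts beyond p and q avoid the other neighbours of x; joined at
-- y they form a p,q-walk, and an induced p,q-path inside it closes with x into an induced cycle
-- of length at least 4.
-- A strongly 2-monophonic chordal graph has a non-edge ab, since the only monophonic set of a
-- complete graph is its whole vertex set.  Every other vertex is an inner vertex of an induced
-- a,b-path, so it has two non-adjacent neighbours and, by the clique property, is an end of no
-- non-edge: ab is the only non-edge.  Conversely, in K_n - e the ends of the missing edge have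
-- all other vertices as common neighbours, so this only non-adjacent pair is monophonic.
module Submission where

open import Defs
open import Data.Bool using (true; false; T; not; _∧_)
import Data.Bool.Properties as Bool
open import Data.Empty using (⊥; ⊥-elim)
open import Data.Fin using (Fin; toℕ; fromℕ; fromℕ<; inject₁; opposite)
  renaming (zero to fzero; suc to fsuc)
import Data.Fin.Permutation as Perm
import Data.Fin.Permutation.Components as PC
import Data.Fin.Properties as Fin
open import Data.Fin.Subset using (Subset; _∈_; ∣_∣; ⁅_⁆) renaming (⊤ to everything)
import Data.Fin.Subset.Properties as Subset
open import Data.List using (List; []; _∷_; length; lookup)
open import Data.List.Membership.Propositional using () renaming (_∈_ to _∈ᴸ_; _∉_ to _∉ᴸ_)
open import Data.List.Membership.Propositional.Properties using (∈-lookup)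
open import Data.List.Relation.Unary.All as All using (All; []; _∷_)
open import Data.List.Relation.Unary.All.Properties using (¬Any⇒All¬)
open import Data.List.Relation.Unary.Any as Any using (Any; here)
open import Data.Nat using (ℕ; zero; suc; _≤_; _<_; z≤n; s≤s; _%_; _∸_; _≡ᵇ_)
import Data.Nat.DivMod as ℕ
import Data.Nat.Properties as ℕ
open import Data.Product using (Σ; ∃; ∃₂; _×_; _,_; proj₁; proj₂)
open import Data.Product.Function.NonDependent.Propositional using (_×-⇔_)
open import Data.Sum using (_⊎_; inj₁; inj₂; [_,_]′; swap; reduce)
import Data.Sum as Sum
open import Data.Sum.Function.Propositional using (_⊎-⇔_)
open import Data.Unit using (⊤; tt)
open import Function using (_∘_)
open import Function.Bundles using (_⇔_; mk⇔; Equivalence; Inverse; Injection)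
open import Function.Definitions using (Injective)
open import Function.Properties.Inverse using (↔⇒↣)
open import Function.Properties.Equivalence using () renaming (refl to ⇔-refl; trans to ⇔-trans; sym to ⇔-sym)
open import Function.Related.TypeIsomorphisms using (¬-cong-⇔)
open import Relation.Binary.PropositionalEquality
  using (_≡_; _≢_; refl; sym; trans; cong; subst; subst₂)
open import Relation.Nullary using (¬_; Dec; yes; no; ¬?)
open import Relation.Nullary.Decidable using (_×-dec_; _⊎-dec_; decidable-stable; dec-true; dec-false)

Consecutive-comm : ∀ {a b} → Consecutive a b ⇔ Consecutive b a
Consecutive-comm = mk⇔ swap swap

Consecutive-suc : ∀ {a b} → Consecutive (suc a) (suc b) ⇔ Consecutive a b
Consecutive-suc = mk⇔ (Sum.map ℕ.suc-injective ℕ.suc-injective) (Sum.map (cong suc) (cong suc))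

Consecutive-zero-suc : ∀ {t} → Consecutive 0 (suc t) ⇔ t ≡ 0
Consecutive-zero-suc = mk⇔ (λ { (inj₁ e) → sym (ℕ.suc-injective e) ; (inj₂ ()) }) (λ { refl → inj₁ refl })

¬Consecutive-refl : ∀ {a} → ¬ Consecutive a a
¬Consecutive-refl = [ ℕ.1+n≢n , ℕ.1+n≢n ]′

¬Consecutive-zero : ∀ {k} → 2 ≤ k → ¬ Consecutive 0 k
¬Consecutive-zero (s≤s (s≤s _)) (inj₁ ())
¬Consecutive-zero (s≤s (s≤s _)) (inj₂ ())

-- reading the path backwards replaces each position a ≤ k by k ∸ a
∸-consecutive : ∀ {k a b} → a ≤ k → b ≤ k → (suc (k ∸ a) ≡ k ∸ b) ⇔ (suc b ≡ a)
∸-consecutive {k} {zero} {b} _ _ =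
  mk⇔ (λ e → ⊥-elim (ℕ.<-irrefl refl (subst (_≤ k) (sym e) (ℕ.m∸n≤m k b)))) (λ ())
∸-consecutive {k} {suc a} a<k b≤k = mk⇔
  (λ e → cong suc (sym (ℕ.∸-cancelˡ-≡ (ℕ.<⇒≤ a<k) b≤k (trans (sym suc-∸) e))))
  (λ { refl → suc-∸ })
  where
  suc-∸ : suc (k ∸ suc a) ≡ k ∸ a
  suc-∸ = sym (ℕ.+-∸-assoc 1 a<k)

Consecutive-∸ : ∀ {k a b} → a ≤ k → b ≤ k → Consecutive (k ∸ a) (k ∸ b) ⇔ Consecutive a b
Consecutive-∸ a≤k b≤k = ⇔-trans (∸-consecutive a≤k b≤k ⊎-⇔ ∸-consecutive b≤k a≤k) Consecutive-comm

suc-mod : ∀ {t N} → t ≤ N → (t < N × suc t % suc N ≡ suc t) ⊎ (t ≡ N × suc t % suc N ≡ 0)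
suc-mod {N = N} t≤N with ℕ.m≤n⇒m<n∨m≡n t≤N
... | inj₁ t<N = inj₁ (t<N , ℕ.m<n⇒m%n≡m (s≤s t<N))
... | inj₂ refl = inj₂ (refl , ℕ.n%n≡0 (suc N))

suc-mod≡0 : ∀ {t N} → t ≤ N → (suc t % suc N ≡ 0) ⇔ (t ≡ N)
suc-mod≡0 t≤N with suc-mod t≤N
... | inj₁ (t<N , e) = mk⇔ (λ e′ → ⊥-elim (ℕ.1+n≢0 (trans (sym e) e′))) (λ { refl → ⊥-elim (ℕ.<-irrefl refl t<N) })
... | inj₂ (t≡N , e) = mk⇔ (λ _ → t≡N) (λ _ → e)

suc-mod≡suc : ∀ {t s N} → t ≤ N → s < N → (suc t % suc N ≡ suc s) ⇔ (t ≡ s)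
suc-mod≡suc t≤N s<N with suc-mod t≤N
... | inj₁ (_ , e) = mk⇔ (λ e′ → ℕ.suc-injective (trans (sym e) e′)) (λ { refl → e })
... | inj₂ (refl , e) = mk⇔ (λ e′ → ⊥-elim (ℕ.0≢1+n (trans (sym e) e′))) (λ { refl → ⊥-elim (ℕ.<-irrefl refl s<N) })

CycConsecutive-zero-suc : ∀ {m} (j : Fin (suc (suc (suc m)))) →
  CycConsecutive (suc (suc (suc m))) fzero (fsuc j) ⇔ (toℕ j ≡ 0 ⊎ toℕ j ≡ suc (suc m))
CycConsecutive-zero-suc j =
  mk⇔ (sym ∘ ℕ.suc-injective) (cong suc ∘ sym)
  ⊎-⇔ ⇔-trans (suc-mod≡0 (Fin.toℕ<n j)) (mk⇔ ℕ.suc-injective (cong suc))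

CycConsecutive-suc-suc : ∀ {m} (i j : Fin (suc (suc (suc m)))) →
  CycConsecutive (suc (suc (suc m))) (fsuc i) (fsuc j) ⇔ Consecutive (toℕ i) (toℕ j)
CycConsecutive-suc-suc i j =
  suc-mod≡suc (Fin.toℕ<n i) (Fin.toℕ<n j) ⊎-⇔ suc-mod≡suc (Fin.toℕ<n j) (Fin.toℕ<n i)

pair-members : ∀ {n} {x y z : Fin n} → z ∈ pair x y → z ≡ x ⊎ z ≡ y
pair-members {x = x} {y} z∈ =
  Sum.map (Subset.x∈⁅y⁆⇒x≡y x) (Subset.x∈⁅y⁆⇒x≡y y) (Subset.x∈p∪q⁻ ⁅ x ⁆ ⁅ y ⁆ z∈)

∈-pairˡ : ∀ {n} (x y : Fin n) → x ∈ pair x y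
∈-pairˡ x y = Subset.x∈p∪q⁺ (inj₁ (Subset.x∈⁅x⁆ x))

∈-pairʳ : ∀ {n} (x y : Fin n) → y ∈ pair x y
∈-pairʳ x y = Subset.x∈p∪q⁺ (inj₂ (Subset.x∈⁅x⁆ y))

∣pair∣≡2 : ∀ {n} {x y : Fin n} → x ≢ y → ∣ pair x y ∣ ≡ 2
∣pair∣≡2 {x = fzero} {fzero} x≢y = ⊥-elim (x≢y refl)
∣pair∣≡2 {x = fzero} {fsuc y} _ = cong suc (trans (cong ∣_∣ (Subset.∪-identityˡ ⁅ y ⁆)) (Subset.∣⁅x⁆∣≡1 y))
∣pair∣≡2 {x = fsuc x} {fzero} _ = cong suc (trans (cong ∣_∣ (Subset.∪-identityʳ ⁅ x ⁆)) (Subset.∣⁅x⁆∣≡1 x))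
∣pair∣≡2 {x = fsuc x} {fsuc y} x≢y = ∣pair∣≡2 (x≢y ∘ cong fsuc)

distinct-members⇒2≤∣S∣ : ∀ {n} {S : Subset n} {x y} → x ∈ S → y ∈ S → x ≢ y → 2 ≤ ∣ S ∣
distinct-members⇒2≤∣S∣ {S = S} x∈S y∈S x≢y = subst (_≤ ∣ S ∣) (∣pair∣≡2 x≢y)
  (Subset.p⊆q⇒∣p∣≤∣q∣ (λ z∈ → [ (λ e → subst (_∈ S) (sym e) x∈S) , (λ e → subst (_∈ S) (sym e) y∈S) ]′ (pair-members z∈)))

full⇒n≤∣S∣ : ∀ {n} {S : Subset n} → (∀ w → w ∈ S) → n ≤ ∣ S ∣
full⇒n≤∣S∣ {n} {S} all = subst (_≤ ∣ S ∣) (Subset.∣⊤∣≡n n) (Subset.p⊆q⇒∣p∣≤∣q∣ {p = everything} (λ {w} _ → all w))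

KminusEdge : ∀ {n} → Fin n → Fin n → Fin n → Fin n → Set
KminusEdge a b u v = u ≢ v × ¬ ((u ≡ a × v ≡ b) ⊎ (u ≡ b × v ≡ a))

IsKminusE : ∀ {n} → Graph n → Fin n → Fin n → Set
IsKminusE G a b = ∀ u v → Adj G u v ⇔ KminusEdge a b u v

module SimpleGraph {n : ℕ} (G : Graph n) (simple : IsSimple G) where

  Vertex : Set
  Vertex = Fin n

  adj? : ∀ u v → Dec (Adj G u v)
  adj? u v = G u v Bool.≟ true

  Adj-irrefl : ∀ {u} → ¬ Adj G u u
  Adj-irrefl {u} e with trans (sym e) (proj₁ simple u)
  ... | ()

  Adj-sym : ∀ {u v} → Adj G u v → Adj G v u
  Adj-sym {u} {v} = trans (proj₂ simple v u)

  Adj-comm : ∀ {u v} → Adj G u v ⇔ Adj G v u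
  Adj-comm = mk⇔ Adj-sym Adj-sym

  Adj⇒≢ : ∀ {u v} → Adj G u v → u ≢ v
  Adj⇒≢ e refl = Adj-irrefl e

  Far : Vertex → Vertex → Set
  Far u w = ¬ Adj G u w × u ≢ w

  Induced : List Vertex → Set
  Induced [] = ⊤
  Induced (_ ∷ []) = ⊤
  Induced (u ∷ v ∷ l) = Adj G u v × All (Far u) l × Induced (v ∷ l)

  Induced-tail : ∀ {u} l → Induced (u ∷ l) → Induced l
  Induced-tail [] _ = tt
  Induced-tail (_ ∷ _) (_ , _ , ind) = ind

  endpoint : Vertex → List Vertex → Vertex
  endpoint s [] = s
  endpoint _ (v ∷ vs) = endpoint v vs

  lookup-endpoint : ∀ s r → lookup (s ∷ r) (fromℕ (length r)) ≡ endpoint s r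
  lookup-endpoint s [] = refl
  lookup-endpoint s (v ∷ r) = lookup-endpoint v r

  Induced-head : ∀ {u} l → Induced (u ∷ l) → ∀ j → (Adj G u (lookup l j) ⇔ toℕ j ≡ 0) × u ≢ lookup l j
  Induced-head (v ∷ l) (u~v , _ , _) fzero = mk⇔ (λ _ → refl) (λ _ → u~v) , Adj⇒≢ u~v
  Induced-head {u} (v ∷ l) (_ , far , _) (fsuc j) = mk⇔ (⊥-elim ∘ proj₁ u-far) (λ ()) , proj₂ u-far
    where
    u-far : Far u (lookup l j)
    u-far = All.lookup far (∈-lookup j)

  Induced-lookup-injective : ∀ L → Induced L → Injective _≡_ _≡_ (lookup L)
  Induced-lookup-injective (u ∷ l) ind {fzero} {fzero} _ = refl
  Induced-lookup-injective (u ∷ l) ind {fzero} {fsuc j} e = ⊥-elim (proj₂ (Induced-head l ind j) e)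
  Induced-lookup-injective (u ∷ l) ind {fsuc i} {fzero} e = ⊥-elim (proj₂ (Induced-head l ind i) (sym e))
  Induced-lookup-injective (u ∷ l) ind {fsuc i} {fsuc j} e =
    cong fsuc (Induced-lookup-injective l (Induced-tail l ind) e)

  Induced-lookup-adj : ∀ L → Induced L → ∀ i j →
    Adj G (lookup L i) (lookup L j) ⇔ Consecutive (toℕ i) (toℕ j)
  Induced-lookup-adj (u ∷ l) ind fzero fzero = mk⇔ (⊥-elim ∘ Adj-irrefl) (⊥-elim ∘ ¬Consecutive-refl)
  Induced-lookup-adj (u ∷ l) ind fzero (fsuc j) =
    ⇔-trans (proj₁ (Induced-head l ind j)) (⇔-sym Consecutive-zero-suc)
  Induced-lookup-adj (u ∷ l) ind (fsuc i) fzero =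
    ⇔-trans Adj-comm (⇔-trans (proj₁ (Induced-head l ind i)) (⇔-trans (⇔-sym Consecutive-zero-suc) Consecutive-comm))
  Induced-lookup-adj (u ∷ l) ind (fsuc i) (fsuc j) =
    ⇔-trans (Induced-lookup-adj l (Induced-tail l ind) i j) (⇔-sym Consecutive-suc)

  Induced-position : ∀ L → Induced L → ∀ {i z t} → lookup L i ≡ z → toℕ i ≡ t →
    ∀ j → (lookup L j ≡ z) ⇔ (toℕ j ≡ t)
  Induced-position L ind refl refl j =
    mk⇔ (cong toℕ ∘ Induced-lookup-injective L ind) (cong (lookup L) ∘ Fin.toℕ-injective)

  Induced⇒InducedPath : ∀ s r → Induced (s ∷ r) → InducedPath G s (endpoint s r)
  Induced⇒InducedPath s r ind = record
    { k = length r
    ; vtx = lookup (s ∷ r)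
    ; inj = Induced-lookup-injective (s ∷ r) ind
    ; start = refl
    ; end = lookup-endpoint s r
    ; induced = Induced-lookup-adj (s ∷ r) ind
    }

  InducedRoute : (Vertex → Set) → Vertex → Vertex → Set
  InducedRoute P s t = Σ (List Vertex) λ r → Induced (s ∷ r) × endpoint s r ≡ t × All P (s ∷ r)


  data Walk (P : Vertex → Set) : Vertex → Vertex → Set where
    stop : ∀ {s} → P s → Walk P s s
    step : ∀ {s t u} → P s → Adj G s t → Walk P t u → Walk P s u

  Walk-start : ∀ {P s t} → Walk P s t → P s
  Walk-start (stop p) = p
  Walk-start (step p _ _) = p

  _++ᵂ_ : ∀ {P s t u} → Walk P s t → Walk P t u → Walk P s u
  stop _ ++ᵂ W′ = W′
  step p a W ++ᵂ W′ = step p a (W ++ᵂ W′)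

  reverseᵂ : ∀ {P s t} → Walk P s t → Walk P t s
  reverseᵂ (stop p) = stop p
  reverseᵂ (step p a W) = reverseᵂ W ++ᵂ step (Walk-start W) (Adj-sym a) (stop p)

  mapᵂ : ∀ {P Q : Vertex → Set} → (∀ {z} → P z → Q z) → ∀ {s t} → Walk P s t → Walk Q s t
  mapᵂ f (stop p) = stop (f p)
  mapᵂ f (step p a W) = step (f p) a (mapᵂ f W)

  Touches : Vertex → Vertex → Set
  Touches s w = s ≡ w ⊎ Adj G s w

  touches? : ∀ s w → Dec (Touches s w)
  touches? s w = (s Fin.≟ w) ⊎-dec adj? s w

  attach-head : ∀ {P : Vertex → Set} {s v} vs → Touches s v → All (Far s) vs → Induced (v ∷ vs) →
    P s → All P (v ∷ vs) → InducedRoute P s (endpoint v vs)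
  attach-head vs (inj₁ refl) _ ind ps (_ ∷ pvs) = vs , ind , refl , ps ∷ pvs
  attach-head vs (inj₂ s~v) far ind ps pvs = _ ∷ vs , (s~v , far , ind) , refl , ps ∷ pvs

  -- cut v ∷ vs at the last vertex that s touches and put s in front
  attach : ∀ {P : Vertex → Set} {s} v vs → Any (Touches s) (v ∷ vs) → Induced (v ∷ vs) →
    P s → All P (v ∷ vs) → InducedRoute P s (endpoint v vs)
  attach v [] (here t) ind ps pvs = attach-head [] t [] ind ps pvs
  attach {s = s} v (v′ ∷ vs) t ind ps (pv ∷ pvs) with Any.any? (touches? s) (v′ ∷ vs)
  ... | yes t′ = attach v′ vs t′ (proj₂ (proj₂ ind)) ps pvs
  ... | no ¬t′ = attach-head (v′ ∷ vs) (Any.head ¬t′ t) (All.map far (¬Any⇒All¬ _ ¬t′)) ind ps (pv ∷ pvs)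
    where
    far : ∀ {w} → ¬ Touches s w → Far s w
    far ¬t = ¬t ∘ inj₂ , ¬t ∘ inj₁

  shorten : ∀ {P s t} → Walk P s t → InducedRoute P s t
  shorten (stop p) = [] , tt , refl , p ∷ []
  shorten (step {t = t} p s~t W) with shorten W
  ... | r , ind , end , ps with attach t r (here (inj₂ s~t)) ind p ps
  ...   | r′ , ind′ , end′ , ps′ = r′ , ind′ , trans end′ end , ps′

  InducedPath-step : ∀ {u v} (P : InducedPath G u v) (j : Fin (InducedPath.k P)) →
    Adj G (InducedPath.vtx P (inject₁ j)) (InducedPath.vtx P (fsuc j))
  InducedPath-step P j = Equivalence.from (induced (inject₁ j) (fsuc j)) (inj₁ (cong suc (Fin.toℕ-inject₁ j)))
    where open InducedPath P

  InducedPath-reverse : ∀ {u v} → InducedPath G u v → InducedPath G v u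
  InducedPath-reverse P = record
    { k = k
    ; vtx = vtx ∘ opposite
    ; inj = λ {i} {j} e →
        trans (sym (Fin.opposite-involutive i)) (trans (cong opposite (inj e)) (Fin.opposite-involutive j))
    ; start = end
    ; end = trans (cong vtx (Fin.opposite-involutive fzero)) start
    ; induced = λ i j → ⇔-trans
        (subst₂ (λ a b → Adj G (vtx (opposite i)) (vtx (opposite j)) ⇔ Consecutive a b)
          (Fin.opposite-prop i) (Fin.opposite-prop j) (induced (opposite i) (opposite j)))
        (Consecutive-∸ (Fin.toℕ≤pred[n] i) (Fin.toℕ≤pred[n] j))
    }
    where open InducedPath P

  interior-index : ∀ {u v} (P : InducedPath G u v) (i : Fin (suc (InducedPath.k P))) →
    InducedPath.vtx P i ≢ u → InducedPath.vtx P i ≢ v →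
    ∃ λ t → toℕ i ≡ suc t × suc (suc t) ≤ InducedPath.k P
  interior-index P fzero ≢u _ = ⊥-elim (≢u (InducedPath.start P))
  interior-index P (fsuc i) _ ≢v = toℕ i , refl , ℕ.≤∧≢⇒< (Fin.toℕ≤pred[n] (fsuc i)) last
    where
    open InducedPath P
    last : suc (toℕ i) ≢ k
    last e = ≢v (trans (cong vtx (Fin.toℕ-injective (trans e (sym (Fin.toℕ-fromℕ k))))) end)

  ends-far : ∀ {u v} (P : InducedPath G u v) → 2 ≤ InducedPath.k P → u ≢ v × ¬ Adj G u v
  ends-far record { k = k ; vtx = vtx ; inj = inj ; start = refl ; end = refl ; induced = induced } 2≤k =
    (λ e → ℕ.<⇒≢ (ℕ.<-≤-trans (s≤s z≤n) 2≤k) (trans (cong toℕ (inj e)) (Fin.toℕ-fromℕ k))) ,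
    λ a → ¬Consecutive-zero 2≤k (subst (Consecutive 0) (Fin.toℕ-fromℕ k) (Equivalence.to (induced fzero (fromℕ k)) a))

  short-path : ∀ {u v} → u ≡ v ⊎ Adj G u v → (P : InducedPath G u v) → ∀ i →
    InducedPath.vtx P i ≡ u ⊎ InducedPath.vtx P i ≡ v
  short-path {u} {v} close P i with InducedPath.vtx P i Fin.≟ u | InducedPath.vtx P i Fin.≟ v
  ... | yes e | _ = inj₁ e
  ... | no _ | yes e = inj₂ e
  ... | no ≢u | no ≢v with interior-index P i ≢u ≢v
  ...   | _ , _ , 2+t≤k = ⊥-elim ([ proj₁ far , proj₂ far ]′ close)
    where
    far : u ≢ v × ¬ Adj G u v
    far = ends-far P (ℕ.≤-trans (s≤s (s≤s z≤n)) 2+t≤k)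

  interior-neighbours : ∀ {u v w} (P : InducedPath G u v) → (∃ λ i → InducedPath.vtx P i ≡ w) →
    w ≢ u → w ≢ v → Σ Vertex λ p → Σ Vertex λ q → Adj G w p × Adj G w q × p ≢ q × ¬ Adj G p q
  interior-neighbours P (i , refl) ≢u ≢v with interior-index P i ≢u ≢v
  ... | t , i≡1+t , 2+t≤k =
    vtx prev , vtx next ,
    Equivalence.from (induced i prev) (inj₂ (trans (cong suc toℕ-prev) (sym i≡1+t))) ,
    Equivalence.from (induced i next) (inj₁ (trans (cong suc i≡1+t) (sym toℕ-next))) ,
    (λ e → ℕ.m≢1+n+m t {1} (trans (sym toℕ-prev) (trans (cong toℕ (inj e)) toℕ-next))) ,
    λ a → far (subst₂ Consecutive toℕ-prev toℕ-next (Equivalence.to (induced prev next) a))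
    where
    open InducedPath P
    prev< : t < suc k
    prev< = ℕ.<-trans (ℕ.n<1+n t) (ℕ.<-trans (ℕ.n<1+n (suc t)) (s≤s 2+t≤k))
    prev next : Fin (suc k)
    prev = fromℕ< prev<
    next = fromℕ< (s≤s 2+t≤k)
    toℕ-prev : toℕ prev ≡ t
    toℕ-prev = Fin.toℕ-fromℕ< prev<
    toℕ-next : toℕ next ≡ suc (suc t)
    toℕ-next = Fin.toℕ-fromℕ< (s≤s 2+t≤k)
    far : ¬ Consecutive t (suc (suc t))
    far (inj₁ e) = ℕ.1+n≢n (sym e)
    far (inj₂ e) = ℕ.m≢1+n+m t {2} (sym e)

  walk-along : ∀ {P : Vertex → Set} K (f : Fin (suc K) → Vertex) →
    (∀ j → Adj G (f (inject₁ j)) (f (fsuc j))) → (∀ j → P (f j)) → Walk P (f fzero) (f (fromℕ K))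
  walk-along zero f _ p = stop (p fzero)
  walk-along (suc K) f adj p = step (p fzero) (adj fzero) (walk-along K (f ∘ fsuc) (adj ∘ fsuc) (p ∘ fsuc))

  walk-from-neighbour : ∀ {x y p} (P : InducedPath G x y) → (∃ λ i → InducedPath.vtx P i ≡ p) →
    Adj G x p → Walk (λ w → w ≡ p ⊎ Far x w) p y
  walk-from-neighbour record { start = refl ; end = refl } (fzero , refl) x~p = ⊥-elim (Adj-irrefl x~p)
  walk-from-neighbour P@record { vtx = vtx ; inj = inj ; start = refl ; end = refl ; induced = induced }
    (fsuc fzero , refl) _ = walk-along _ (vtx ∘ fsuc) (InducedPath-step P ∘ fsuc) near
    where
    near : ∀ j → vtx (fsuc j) ≡ vtx (fsuc fzero) ⊎ Far (vtx fzero) (vtx (fsuc j))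
    near fzero = inj₁ refl
    near (fsuc j) = inj₂ ( ¬Consecutive-zero (s≤s (s≤s z≤n)) ∘ Equivalence.to (induced fzero (fsuc (fsuc j)))
                         , 0≢2+j ∘ inj )
      where
      0≢2+j : fzero ≢ fsuc (fsuc j)
      0≢2+j ()
  walk-from-neighbour record { start = refl ; end = refl ; induced = induced } (fsuc (fsuc i) , refl) x~p =
    ⊥-elim (¬Consecutive-zero (s≤s (s≤s z≤n)) (Equivalence.to (induced fzero (fsuc (fsuc i))) x~p))

  close-cycle : ∀ {x a b c} rest → Induced (a ∷ b ∷ c ∷ rest) →
    (∀ {z} → z ∈ᴸ a ∷ b ∷ c ∷ rest → Adj G x z ⇔ (z ≡ a ⊎ z ≡ endpoint c rest)) →
    x ∉ᴸ a ∷ b ∷ c ∷ rest → LongInducedCycle G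
  close-cycle {x} {a} {b} {c} rest ind x~ends x∉L = record
    { m = length rest
    ; vtx = lookup (x ∷ L)
    ; inj = inj
    ; induced = induced
    }
    where
    L : List Vertex
    L = a ∷ b ∷ c ∷ rest
    x~lookup : ∀ j → Adj G x (lookup L j) ⇔ (toℕ j ≡ 0 ⊎ toℕ j ≡ suc (suc (length rest)))
    x~lookup j = ⇔-trans (x~ends (∈-lookup j))
      (Induced-position L ind {fzero} refl refl j
       ⊎-⇔ Induced-position L ind (lookup-endpoint a (b ∷ c ∷ rest)) (Fin.toℕ-fromℕ _) j)
    inj : Injective _≡_ _≡_ (lookup (x ∷ L))
    inj {fzero} {fzero} _ = refl
    inj {fzero} {fsuc j} e = ⊥-elim (x∉L (subst (_∈ᴸ L) (sym e) (∈-lookup j)))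
    inj {fsuc i} {fzero} e = ⊥-elim (x∉L (subst (_∈ᴸ L) e (∈-lookup i)))
    inj {fsuc i} {fsuc j} e = cong fsuc (Induced-lookup-injective L ind e)
    induced : ∀ i j → Adj G (lookup (x ∷ L) i) (lookup (x ∷ L) j) ⇔
      CycConsecutive (suc (suc (suc (length rest)))) i j
    induced fzero fzero = mk⇔ (⊥-elim ∘ Adj-irrefl) (λ { (inj₁ ()) ; (inj₂ ()) })
    induced fzero (fsuc j) = ⇔-trans (x~lookup j) (⇔-sym (CycConsecutive-zero-suc j))
    induced (fsuc i) fzero =
      ⇔-trans Adj-comm (⇔-trans (x~lookup i) (⇔-trans (⇔-sym (CycConsecutive-zero-suc i)) (mk⇔ swap swap)))
    induced (fsuc i) (fsuc j) =
      ⇔-trans (Induced-lookup-adj L ind i j) (⇔-sym (CycConsecutive-suc-suc i j))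

  cycle-through : ∀ {x p q} → Adj G x p → Adj G x q → ¬ Adj G p q → p ≢ q →
    InducedRoute (λ z → (z ≡ p ⊎ z ≡ q) ⊎ Far x z) p q → LongInducedCycle G
  cycle-through _ _ _ p≢q ([] , _ , p≡q , _) = ⊥-elim (p≢q p≡q)
  cycle-through _ _ p≁q _ (_ ∷ [] , (p~q , _) , refl , _) = ⊥-elim (p≁q p~q)
  cycle-through {x} {p} x~p x~q _ _ (b ∷ c ∷ rest , ind , refl , near) = close-cycle rest ind x~ends x∉
    where
    ends⇒adj : ∀ {z} → z ≡ p ⊎ z ≡ endpoint c rest → Adj G x z
    ends⇒adj (inj₁ refl) = x~p
    ends⇒adj (inj₂ refl) = x~q
    adj⇒ends : ∀ {z} → (z ≡ p ⊎ z ≡ endpoint c rest) ⊎ Far x z → Adj G x z → z ≡ p ⊎ z ≡ endpoint c rest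
    adj⇒ends (inj₁ ends) _ = ends
    adj⇒ends (inj₂ (x≁z , _)) x~z = ⊥-elim (x≁z x~z)
    x~ends : ∀ {z} → z ∈ᴸ p ∷ b ∷ c ∷ rest → Adj G x z ⇔ (z ≡ p ⊎ z ≡ endpoint c rest)
    x~ends z∈ = mk⇔ (adj⇒ends (All.lookup near z∈)) ends⇒adj
    x∉ : x ∉ᴸ p ∷ b ∷ c ∷ rest
    x∉ x∈ with All.lookup near x∈
    ... | inj₁ ends = Adj-irrefl (ends⇒adj ends)
    ... | inj₂ (_ , x≢x) = x≢x refl

  walk-to-end : ∀ {x y z} → ¬ Adj G x y → (∀ w → InJ G x y w) → Adj G x z →
    Walk (λ w → w ≡ z ⊎ Far x w) z y
  walk-to-end {z = z} x≁y covers x~z with covers z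
  ... | inj₁ refl = ⊥-elim (Adj-irrefl x~z)
  ... | inj₂ (inj₁ refl) = ⊥-elim (x≁y x~z)
  ... | inj₂ (inj₂ (P , onP)) = walk-from-neighbour P onP x~z

  neighbourhood-clique : Chordal G → ∀ {x y} → ¬ Adj G x y → (∀ w → InJ G x y w) →
    ∀ {p q} → Adj G x p → Adj G x q → p ≢ q → Adj G p q
  neighbourhood-clique chordal {x} {y} x≁y covers {p} {q} x~p x~q p≢q with adj? p q
  ... | yes p~q = p~q
  ... | no p≁q = ⊥-elim (chordal (cycle-through x~p x~q p≁q p≢q (shorten (p⋯y ++ᵂ reverseᵂ q⋯y))))
    where
    Near : Vertex → Set
    Near z = (z ≡ p ⊎ z ≡ q) ⊎ Far x z
    p⋯y : Walk Near p y
    p⋯y = mapᵂ (Sum.map₁ inj₁) (walk-to-end x≁y covers x~p)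
    q⋯y : Walk Near q y
    q⋯y = mapᵂ (Sum.map₁ inj₂) (walk-to-end x≁y covers x~q)

  InJ-sym : ∀ {u v w} → InJ G u v w → InJ G v u w
  InJ-sym (inj₁ e) = inj₂ (inj₁ e)
  InJ-sym (inj₂ (inj₁ e)) = inj₁ e
  InJ-sym (inj₂ (inj₂ (P , i , e))) =
    inj₂ (inj₂ (InducedPath-reverse P , opposite i , trans (cong (InducedPath.vtx P) (Fin.opposite-involutive i)) e))

  InJ-trivial : ∀ {u v w} → u ≡ v ⊎ Adj G u v → InJ G u v w → w ≡ u ⊎ w ≡ v
  InJ-trivial _ (inj₁ e) = inj₁ e
  InJ-trivial _ (inj₂ (inj₁ e)) = inj₂ e
  InJ-trivial close (inj₂ (inj₂ (P , i , refl))) = short-path close P i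

  InJ-diag : ∀ {u w} → InJ G u u w → w ≡ u
  InJ-diag = reduce ∘ InJ-trivial (inj₁ refl)

  InJ-within : ∀ {x y x′ y′ w} → x′ ≡ x ⊎ x′ ≡ y → y′ ≡ x ⊎ y′ ≡ y → InJ G x′ y′ w → InJ G x y w
  InJ-within (inj₁ refl) (inj₂ refl) J = J
  InJ-within (inj₂ refl) (inj₁ refl) J = InJ-sym J
  InJ-within (inj₁ refl) (inj₁ refl) J = inj₁ (InJ-diag J)
  InJ-within (inj₂ refl) (inj₂ refl) J = inj₂ (inj₁ (InJ-diag J))

  monophonic-pair⇒covers : ∀ {x y} → Monophonic G (pair x y) → ∀ w → InJ G x y w
  monophonic-pair⇒covers mono w with mono w
  ... | _ , _ , x′∈ , y′∈ , J = InJ-within (pair-members x′∈) (pair-members y′∈) J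

  common-neighbours⇒monophonic : ∀ {x y} → x ≢ y → ¬ Adj G x y →
    (∀ w → w ≢ x → w ≢ y → Adj G x w × Adj G w y) → Monophonic G (pair x y)
  common-neighbours⇒monophonic {x} {y} x≢y x≁y common w with w Fin.≟ x | w Fin.≟ y
  ... | yes e | _ = x , x , ∈-pairˡ x y , ∈-pairˡ x y , inj₁ e
  ... | no _ | yes e = y , y , ∈-pairʳ x y , ∈-pairʳ x y , inj₁ e
  ... | no w≢x | no w≢y = x , y , ∈-pairˡ x y , ∈-pairʳ x y ,
    inj₂ (inj₂ (Induced⇒InducedPath x (w ∷ y ∷ []) path , fsuc fzero , refl))
    where
    path : Induced (x ∷ w ∷ y ∷ [])
    path = proj₁ (common w w≢x w≢y) , (x≁y , x≢y) ∷ [] , proj₂ (common w w≢x w≢y) , [] , tt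

  ∈-or-2≤∣S∣ : ∀ {S} → Monophonic G S → ∀ w → w ∈ S ⊎ 2 ≤ ∣ S ∣
  ∈-or-2≤∣S∣ {S} mono w with mono w
  ... | x , y , x∈S , y∈S , J with x Fin.≟ y
  ...   | yes refl = inj₁ (subst (_∈ S) (sym (InJ-diag J)) x∈S)
  ...   | no x≢y = inj₂ (distinct-members⇒2≤∣S∣ x∈S y∈S x≢y)

  monophonic-size≥2 : ∀ {S a b} → a ≢ b → Monophonic G S → 2 ≤ ∣ S ∣
  monophonic-size≥2 {a = a} {b} a≢b mono with ∈-or-2≤∣S∣ mono a | ∈-or-2≤∣S∣ mono b
  ... | inj₂ 2≤∣S∣ | _ = 2≤∣S∣
  ... | inj₁ _ | inj₂ 2≤∣S∣ = 2≤∣S∣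
  ... | inj₁ a∈S | inj₁ b∈S = distinct-members⇒2≤∣S∣ a∈S b∈S a≢b

  complete⇒monophonic-full : (∀ u v → u ≢ v → Adj G u v) → ∀ {S} → Monophonic G S → ∀ w → w ∈ S
  complete⇒monophonic-full complete {S} mono w with mono w
  ... | x , y , x∈S , y∈S , J =
    [ (λ e → subst (_∈ S) (sym e) x∈S) , (λ e → subst (_∈ S) (sym e) y∈S) ]′ (InJ-trivial close J)
    where
    close : x ≡ y ⊎ Adj G x y
    close with x Fin.≟ y
    ... | yes e = inj₁ e
    ... | no x≢y = inj₂ (complete x y x≢y)

  nonedges-meet : Chordal G → ∀ {a b x y} → (∀ w → InJ G a b w) →
    ¬ Adj G x y → (∀ w → InJ G x y w) → x ≡ a ⊎ x ≡ b
  nonedges-meet chordal {a} {b} {x} coversAB x≁y coversXY with x Fin.≟ a | x Fin.≟ b | coversAB x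
  ... | yes e | _ | _ = inj₁ e
  ... | no _ | yes e | _ = inj₂ e
  ... | no x≢a | no _ | inj₁ e = ⊥-elim (x≢a e)
  ... | no _ | no x≢b | inj₂ (inj₁ e) = ⊥-elim (x≢b e)
  ... | no x≢a | no x≢b | inj₂ (inj₂ (P , onP)) with interior-neighbours P onP x≢a x≢b
  ...   | _ , _ , x~p , x~q , p≢q , p≁q = ⊥-elim (p≁q (neighbourhood-clique chordal x≁y coversXY x~p x~q p≢q))

  nonedge? : Dec (∃₂ λ a b → a ≢ b × ¬ Adj G a b)
  nonedge? = Fin.any? λ a → Fin.any? λ b → ¬? (a Fin.≟ b) ×-dec ¬? (adj? a b)

  nonedges⇒isKminusE : ∀ {a b} → ¬ Adj G a b → (∀ x y → x ≢ y → ¬ Adj G x y → x ≡ a ⊎ x ≡ b) →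
    IsKminusE G a b
  nonedges⇒isKminusE {a} {b} a≁b meet u v = mk⇔ to from
    where
    to : Adj G u v → KminusEdge a b u v
    to u~v = Adj⇒≢ u~v , [ (λ (u≡a , v≡b) → a≁b (subst₂ (Adj G) u≡a v≡b u~v))
                         , (λ (u≡b , v≡a) → a≁b (subst₂ (Adj G) v≡a u≡b (Adj-sym u~v))) ]′
    from : KminusEdge a b u v → Adj G u v
    from (u≢v , ¬ab) with adj? u v
    ... | yes u~v = u~v
    ... | no u≁v = ⊥-elim (ends (meet u v u≢v u≁v) (meet v u (u≢v ∘ sym) (u≁v ∘ Adj-sym)))
      where
      ends : u ≡ a ⊎ u ≡ b → v ≡ a ⊎ v ≡ b → ⊥
      ends (inj₁ u≡a) (inj₁ v≡a) = u≢v (trans u≡a (sym v≡a))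
      ends (inj₁ u≡a) (inj₂ v≡b) = ¬ab (inj₁ (u≡a , v≡b))
      ends (inj₂ u≡b) (inj₁ v≡a) = ¬ab (inj₂ (u≡b , v≡a))
      ends (inj₂ u≡b) (inj₂ v≡b) = u≢v (trans u≡b (sym v≡b))

  stronglyTwoMonophonic⇒isKminusE : 3 ≤ n → Chordal G → StronglyTwoMonophonic G →
    ∃₂ λ a b → a ≢ b × IsKminusE G a b
  stronglyTwoMonophonic⇒isKminusE 3≤n chordal (((S , mono , ∣S∣≡2) , _) , strong) with nonedge?
  ... | yes (a , b , a≢b , a≁b) =
    a , b , a≢b , nonedges⇒isKminusE a≁b (λ x y x≢y x≁y →
      nonedges-meet chordal (covers a≢b a≁b) x≁y (covers x≢y x≁y))
    where
    covers : ∀ {x y} → x ≢ y → ¬ Adj G x y → ∀ w → InJ G x y w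
    covers x≢y x≁y = monophonic-pair⇒covers (strong _ _ x≢y (Bool.¬-not x≁y))
  ... | no ∄nonedge = ⊥-elim (ℕ.<⇒≱ (ℕ.n<1+n 2) (subst (3 ≤_) ∣S∣≡2 (ℕ.≤-trans 3≤n n≤∣S∣)))
    where
    complete : ∀ u v → u ≢ v → Adj G u v
    complete u v u≢v = decidable-stable (adj? u v) (λ u≁v → ∄nonedge (u , v , u≢v , u≁v))
    n≤∣S∣ : n ≤ ∣ S ∣
    n≤∣S∣ = full⇒n≤∣S∣ (complete⇒monophonic-full complete mono)

  isKminusE⇒stronglyTwoMonophonic : ∀ {a b} → a ≢ b → IsKminusE G a b → StronglyTwoMonophonic G
  isKminusE⇒stronglyTwoMonophonic {a} {b} a≢b ke =
    ((pair a b , mono-ab , ∣pair∣≡2 a≢b) , λ _ → monophonic-size≥2 a≢b) , strong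
    where
    a≁b : ¬ Adj G a b
    a≁b a~b = proj₂ (Equivalence.to (ke a b) a~b) (inj₁ (refl , refl))
    a~w~b : ∀ w → w ≢ a → w ≢ b → Adj G a w × Adj G w b
    a~w~b w w≢a w≢b =
      Equivalence.from (ke a w) (w≢a ∘ sym , [ w≢b ∘ proj₂ , a≢b ∘ proj₁ ]′) ,
      Equivalence.from (ke w b) (w≢b , [ w≢a ∘ proj₁ , w≢b ∘ proj₁ ]′)
    mono-ab : Monophonic G (pair a b)
    mono-ab = common-neighbours⇒monophonic a≢b a≁b a~w~b
    mono-ba : Monophonic G (pair b a)
    mono-ba = common-neighbours⇒monophonic (a≢b ∘ sym) (a≁b ∘ Adj-sym)
      (λ w w≢b w≢a → let a~w , w~b = a~w~b w w≢a w≢b in Adj-sym w~b , Adj-sym a~w)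
    strong : ∀ x y → x ≢ y → G x y ≡ false → Monophonic G (pair x y)
    strong x y x≢y Gxy≡false with (x Fin.≟ a ×-dec y Fin.≟ b) ⊎-dec (x Fin.≟ b ×-dec y Fin.≟ a)
    ... | yes (inj₁ (refl , refl)) = mono-ab
    ... | yes (inj₂ (refl , refl)) = mono-ba
    ... | no ¬ab = ⊥-elim (Bool.not-¬ Gxy≡false (Equivalence.from (ke x y) (x≢y , ¬ab)))

-- the value of KminusE at two vertices outside {0, 1}
toℕ-≡ᵇ-false : ∀ {N} (i j : Fin N) → (not (toℕ i ≡ᵇ toℕ j) ∧ true) ≡ true ⇔ i ≢ j
toℕ-≡ᵇ-false i j with toℕ i ≡ᵇ toℕ j in eq
... | true = mk⇔ (λ ()) (λ i≢j → ⊥-elim (i≢j (Fin.toℕ-injective (ℕ.≡ᵇ⇒≡ _ _ (subst T (sym eq) tt)))))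
... | false = mk⇔ (λ _ i≡j → subst T eq (ℕ.≡⇒≡ᵇ _ _ (cong toℕ i≡j))) (λ _ → refl)

KminusE-isKminusE : ∀ m → IsKminusE (KminusE (suc (suc m))) fzero (fsuc fzero)
KminusE-isKminusE m fzero fzero = mk⇔ (λ ()) (λ (≢ , _) → ⊥-elim (≢ refl))
KminusE-isKminusE m fzero (fsuc fzero) = mk⇔ (λ ()) (λ (_ , ¬ab) → ⊥-elim (¬ab (inj₁ (refl , refl))))
KminusE-isKminusE m (fsuc fzero) fzero = mk⇔ (λ ()) (λ (_ , ¬ab) → ⊥-elim (¬ab (inj₂ (refl , refl))))
KminusE-isKminusE m (fsuc fzero) (fsuc fzero) = mk⇔ (λ ()) (λ (≢ , _) → ⊥-elim (≢ refl))
KminusE-isKminusE m fzero (fsuc (fsuc j)) =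
  mk⇔ (λ _ → (λ ()) , λ { (inj₁ (_ , ())) ; (inj₂ (() , _)) }) (λ _ → refl)
KminusE-isKminusE m (fsuc fzero) (fsuc (fsuc j)) =
  mk⇔ (λ _ → (λ ()) , λ { (inj₁ (() , _)) ; (inj₂ (_ , ())) }) (λ _ → refl)
KminusE-isKminusE m (fsuc (fsuc i)) fzero =
  mk⇔ (λ _ → (λ ()) , λ { (inj₁ (() , _)) ; (inj₂ (() , _)) }) (λ _ → refl)
KminusE-isKminusE m (fsuc (fsuc i)) (fsuc fzero) =
  mk⇔ (λ _ → (λ ()) , λ { (inj₁ (() , _)) ; (inj₂ (() , _)) }) (λ _ → refl)
KminusE-isKminusE m (fsuc (fsuc i)) (fsuc (fsuc j)) = mk⇔
  (λ e → Equivalence.to distinct e , λ { (inj₁ (() , _)) ; (inj₂ (() , _)) })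
  (Equivalence.from distinct ∘ proj₁)
  where
  distinct : (not (toℕ i ≡ᵇ toℕ j) ∧ true) ≡ true ⇔ fsuc (fsuc i) ≢ fsuc (fsuc j)
  distinct = toℕ-≡ᵇ-false (fsuc (fsuc i)) (fsuc (fsuc j))

KminusEdge-image : ∀ {n m} {g : Fin n → Fin m} → Injective _≡_ _≡_ g →
  ∀ {a b u v a′ b′} → g a ≡ a′ → g b ≡ b′ → KminusEdge a b u v ⇔ KminusEdge a′ b′ (g u) (g v)
KminusEdge-image {g = g} g-inj refl refl =
  ¬-cong-⇔ image ×-⇔ ¬-cong-⇔ ((image ×-⇔ image) ⊎-⇔ (image ×-⇔ image))
  where
  image : ∀ {x y} → (x ≡ y) ⇔ (g x ≡ g y)
  image = mk⇔ (cong g) g-inj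

transpose-moves : ∀ {N} (i j : Fin N) → PC.transpose i j i ≡ j
transpose-moves i j rewrite dec-true (i Fin.≟ i) refl = refl

transpose-fixes : ∀ {N} {i j k : Fin N} → k ≢ i → k ≢ j → PC.transpose i j k ≡ k
transpose-fixes {i = i} {j} {k} k≢i k≢j rewrite dec-false (k Fin.≟ i) k≢i | dec-false (k Fin.≟ j) k≢j = refl

transpose-injective : ∀ {N} (i j : Fin N) → Injective _≡_ _≡_ (PC.transpose i j)
transpose-injective i j e =
  trans (sym (PC.transpose-inverse j i)) (trans (cong (PC.transpose j i) e) (PC.transpose-inverse j i))

-- first swap a into place, then the image of b
permutation-sending : ∀ {N} {a b : Fin (suc (suc N))} → a ≢ b →
  Σ (Perm.Permutation′ (suc (suc N))) λ π → π Perm.⟨$⟩ʳ a ≡ fzero × π Perm.⟨$⟩ʳ b ≡ fsuc fzero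
permutation-sending {N} {a} {b} a≢b =
  Perm.transpose a fzero Perm.∘ₚ Perm.transpose b′ (fsuc fzero) ,
  trans (cong (PC.transpose b′ (fsuc fzero)) (transpose-moves a fzero)) (transpose-fixes 0≢b′ (λ ())) ,
  transpose-moves b′ (fsuc fzero)
  where
  b′ : Fin (suc (suc N))
  b′ = PC.transpose a fzero b
  0≢b′ : fzero ≢ b′
  0≢b′ e = a≢b (transpose-injective a fzero (trans (transpose-moves a fzero) e))

isKminusE⇒Isomorphic : ∀ {N} {G : Graph (suc (suc N))} {a b} → a ≢ b → IsKminusE G a b →
  Isomorphic G (KminusE (suc (suc N)))
isKminusE⇒Isomorphic {N} {G} a≢b ke with permutation-sending a≢b
... | π , πa , πb = π , λ u v → Bool.⇔→≡ (⇔-trans (ke u v)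
  (⇔-trans (KminusEdge-image (Injection.injective (↔⇒↣ π)) πa πb) (⇔-sym (KminusE-isKminusE N (to u) (to v)))))
  where open Inverse π

Isomorphic⇒isKminusE : ∀ {n m} {G : Graph n} → Isomorphic G (KminusE (suc (suc m))) →
  ∃₂ λ a b → a ≢ b × IsKminusE G a b
Isomorphic⇒isKminusE {m = m} {G} (f , iso) =
  from fzero , from (fsuc fzero) ,
  (λ e → 0≢1 (trans (sym (strictlyInverseˡ fzero)) (trans (cong to e) (strictlyInverseˡ (fsuc fzero))))) ,
  λ u v → ⇔-trans (preserves u v) (⇔-trans (KminusE-isKminusE m (to u) (to v))
    (⇔-sym (KminusEdge-image (Injection.injective (↔⇒↣ f)) (strictlyInverseˡ fzero) (strictlyInverseˡ (fsuc fzero)))))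
  where
  open Inverse f
  0≢1 : fzero ≢ fsuc fzero
  0≢1 ()
  preserves : ∀ u v → Adj G u v ⇔ Adj (KminusE (suc (suc m))) (to u) (to v)
  preserves u v = subst (λ b → Adj G u v ⇔ (b ≡ true)) (iso u v) ⇔-refl

corollary3p6 : (n : ℕ) (G : Graph n) → IsSimple G → 3 ≤ n → Chordal G →
    (StronglyTwoMonophonic G ⇔ Σ ℕ (λ m → 3 ≤ m × Isomorphic G (KminusE m)))
corollary3p6 n G simple 3≤n@(s≤s (s≤s (s≤s _))) chordal = mk⇔ forward backward
  where
  open SimpleGraph G simple
  forward : StronglyTwoMonophonic G → Σ ℕ λ m → 3 ≤ m × Isomorphic G (KminusE m)
  forward strongly with stronglyTwoMonophonic⇒isKminusE 3≤n chordal strongly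
  ... | _ , _ , a≢b , ke = n , 3≤n , isKminusE⇒Isomorphic a≢b ke
  backward : Σ ℕ (λ m → 3 ≤ m × Isomorphic G (KminusE m)) → StronglyTwoMonophonic G
  backward (_ , s≤s (s≤s _) , iso) with Isomorphic⇒isKminusE iso
  ... | _ , _ , a≢b , ke = isKminusE⇒stronglyTwoMonophonic a≢b ke
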